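{- For every integer $n\ge 3$, let $W_n$ be the wheel obtained from an $n$-cycle by adding a new vertex adjacent to every vertex of the cycle. Then $ch_3^d(W_n)\le 6$ for every $n\ge 3$, and $ch_3^d(W_5)=6$.
   Context: All graphs are finite and simple. For a graph $G$ and integer $r\ge1$, an $r$-dynamic coloring is a proper vertex coloring $\phi$ such that for every vertex $v$, $|\phi(N_G(v))|\ge\min\{r,\deg_G(v)\}$. Given a list assignment $L$, $G$ is $r$-dynamically $L$-colorable if it has an $r$-dynamic coloring $\phi$ with $\phi(v)\in L(v)$ for all $v$. The list $r$-dynamic chromatic number $ch_r^d(G)$ is the least $k$ such that $G$ is $r$-dynamically $L$-colorable for every list assignment $L$ with $|L(v)|\ge k$ for all $v$. -}

module Defs where

open import Data.Nat using (ℕ; zero; suc; _+_; _≤_; _⊓_; NonZero)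
open import Data.Nat.DivMod using (_%_)
open import Data.Fin using (Fin; toℕ)
import Data.Fin as F
open import Data.List using (List; length; filter; allFin)
open import Data.Bool using (Bool; true; false; T; _∨_; _∧_; not)
open import Relation.Nullary.Decidable using (T?)
open import Data.Nat using (_≡ᵇ_)
open import Data.List.Relation.Unary.Unique.Propositional using (Unique)
open import Data.List.Relation.Unary.All using (All)
open import Data.List.Membership.Propositional using (_∈_)
open import Data.Product using (Σ; ∃; _×_; _,_)
open import Data.Sum using (_⊎_)
open import Data.Empty using (⊥)
open import Relation.Nullary using (¬_)
open import Relation.Unary using (Decidable)
open import Relation.Binary.PropositionalEquality using (_≡_)

-- Simplicity (symmetry, irreflexivity)
-- is not bundled; the wheel defined below is symmetric and loopless by construction.
Graph : ℕ → Set
Graph n = Fin n → Fin n → Bool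

Adj : ∀ {n} → Graph n → Fin n → Fin n → Set
Adj G u v = T (G u v)

deg : ∀ {n} (G : Graph n) → Fin n → ℕ
deg G v = length (filter (λ u → T? (G v u)) (allFin _))

Coloring : ℕ → Set
Coloring n = Fin n → ℕ

Proper : ∀ {n} → Graph n → Coloring n → Set
Proper G φ = ∀ u v → Adj G u v → ¬ (φ u ≡ φ v)

-- "at least k distinct colours appear on N(v)":
-- there is a duplicate-free list of k colours, each used on some neighbour of v.
-- This is |φ(N_G(v))| ≥ k.
ColoursOnNbhdAtLeast : ∀ {n} → Graph n → Coloring n → Fin n → ℕ → Set
ColoursOnNbhdAtLeast G φ v k =
  Σ (List ℕ) λ cs → length cs ≡ k × Unique cs × All (λ c → ∃ λ u → Adj G v u × φ u ≡ c) cs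

IsDynamic : ∀ {n} → ℕ → Graph n → Coloring n → Set
IsDynamic r G φ = Proper G φ × (∀ v → ColoursOnNbhdAtLeast G φ v (r ⊓ deg G v))

ListAssignment : ℕ → Set
ListAssignment n = Fin n → List ℕ

-- |L(v)| ≥ k for every v (lists are duplicate-free, so length = size of the set)
HasSizeAtLeast : ∀ {n} → ℕ → ListAssignment n → Set
HasSizeAtLeast k L = ∀ v → Unique (L v) × k ≤ length (L v)

DynamicallyLColorable : ∀ {n} → ℕ → Graph n → ListAssignment n → Set
DynamicallyLColorable r G L =
  Σ (Coloring _) λ φ → IsDynamic r G φ × (∀ v → φ v ∈ L v)

ChDynAtMost : ∀ {n} → ℕ → Graph n → ℕ → Set
ChDynAtMost r G k = ∀ (L : ListAssignment _) → HasSizeAtLeast k L → DynamicallyLColorable r G L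

-- ch_r^d(G) = k : least such k. (ChDynAtMost is monotone in k, so
-- "≤ k and not ≤ k-1" is exactly "least".)
ChDynEq : ∀ {n} → ℕ → Graph n → ℕ → Set
ChDynEq r G zero    = ChDynAtMost r G zero
ChDynEq r G (suc k) = ChDynAtMost r G (suc k) × ¬ ChDynAtMost r G k

cycleAdj : (n : ℕ) → .{{_ : NonZero n}} → Fin n → Fin n → Bool
cycleAdj n i j = (toℕ j ≡ᵇ (suc (toℕ i) % n)) ∨ (toℕ i ≡ᵇ (suc (toℕ j) % n))

-- Wheel W_n on Fin (suc n): vertex zero is the hub, vertices suc i (i : Fin n)
-- form the n-cycle; the hub is adjacent to every rim vertex.
wheel : (n : ℕ) → .{{_ : NonZero n}} → Graph (suc n)
wheel n F.zero    F.zero    = false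
wheel n F.zero    (F.suc j) = true
wheel n (F.suc i) F.zero    = true
wheel n (F.suc i) (F.suc j) = cycleAdj n i j

-- Upper bound: give the hub any colour h from its list and colour the rim
-- 0, 1, …, n-1 greedily, letting rim vertex i avoid h, the colours of i-1
-- and i-2 and the colours of 0 and 1; five forbidden colours leave a choice
-- in every list of size 6. Then any two rim vertices at cyclic distance 1
-- or 2 get distinct colours (across the wrap-around this is why 0 and 1 are
-- avoided), so the colouring is proper, the hub sees three colours on 0, 1,
-- 2, and a rim vertex sees h and the two distinct colours of its rim
-- neighbours.
-- Lower bound: in a 3-dynamic colouring of W₅ the two rim neighbours of a rim
-- vertex v must differ, since together with the hub they form all of N(v).
-- In C₅ any two vertices are adjacent or have a common neighbour, so all six
-- vertices of W₅ get distinct colours, which lists {0,…,4} cannot provide.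
module Submission where

open import Defs
open import Data.Nat using (ℕ; zero; suc; _+_; pred; _≤_; _<_; _⊓_; NonZero; z≤n; s≤s; s≤s⁻¹; _<?_; _≤?_)
open import Data.Nat.Properties
  using (≤-refl; ≤-trans; ≤-antisym; <-trans; ≮⇒≥; <⇒≱; n<1+n; m≤n⇒m⊓n≡m; m⊓n≤m;
         suc-pred; ≡ᵇ⇒≡; ≡⇒≡ᵇ; module ≤-Reasoning)
import Data.Nat.Properties as ℕ
open import Data.Nat.DivMod using (_%_; _mod_; m%n<n; m<n⇒m%n≡m; n%n≡0)
open import Data.Fin using (Fin; toℕ; fromℕ<; #_)
import Data.Fin as F
open import Data.Fin.Properties using (toℕ-fromℕ<; toℕ-injective; toℕ<n)
import Data.Fin.Properties as Fin
open import Data.Bool.Properties using (T-∨)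
open import Data.Unit using (tt)
open import Data.Empty using (⊥-elim)
open import Data.Product using (_×_; _,_; proj₁; proj₂; ∃)
open import Data.Sum using (inj₁; inj₂; _⊎_)
import Data.Sum as Sum
open import Data.List using (List; []; _∷_; [_]; length; _++_; take)
open import Data.List.Properties using (length-++-sucʳ; length-take)
open import Data.List.Relation.Unary.All using (All; []; _∷_; all?)
import Data.List.Relation.Unary.All as All
open import Data.List.Relation.Unary.All.Properties using (¬All⇒Any¬)
import Data.List.Relation.Unary.All.Properties as All
open import Data.List.Relation.Unary.AllPairs using ([]; _∷_)
open import Data.List.Relation.Unary.Unique.Propositional using (Unique)
import Data.List.Relation.Unary.Unique.Propositional.Properties as Unique
open import Data.List.Relation.Unary.Any using (here; there)
open import Data.List.Membership.Propositional using (_∈_; _∉_; find)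
open import Data.List.Membership.Propositional.Properties using (∈-∃++; ∈-++⁻; ∈-++⁺ˡ; ∈-++⁺ʳ)
import Data.List.Membership.DecPropositional as DecMembership
open import Function using (Equivalence)
open import Relation.Nullary using (¬_; yes; no; Dec)
open import Relation.Nullary.Decidable using (T?; _→-dec_; True; toWitness)
open import Relation.Binary.Definitions using (DecidableEquality)
open import Relation.Binary.PropositionalEquality
  using (_≡_; _≢_; refl; sym; trans; cong; subst; ≢-sym)

Unique⇒length≤ : ∀ {a} {A : Set a} {xs ys : List A} →
                 Unique xs → All (_∈ ys) xs → length xs ≤ length ys
Unique⇒length≤ [] [] = z≤n
Unique⇒length≤ {xs = x ∷ xs} (x∉xs ∷ xs-unique) (x∈ys ∷ xs⊆ys) with ∈-∃++ x∈ys
... | ys₁ , ys₂ , refl = begin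
  suc (length xs)           ≤⟨ s≤s (Unique⇒length≤ xs-unique (All.zipWith drop-x (xs⊆ys , x∉xs))) ⟩
  suc (length (ys₁ ++ ys₂)) ≡⟨ length-++-sucʳ ys₁ x ys₂ ⟨
  length (ys₁ ++ x ∷ ys₂)   ∎
  where
  open ≤-Reasoning
  drop-x : ∀ {y} → y ∈ ys₁ ++ x ∷ ys₂ × x ≢ y → y ∈ ys₁ ++ ys₂
  drop-x (y∈ , x≢y) with ∈-++⁻ ys₁ y∈
  ... | inj₁ y∈ys₁         = ∈-++⁺ˡ y∈ys₁
  ... | inj₂ (here refl)   = ⊥-elim (x≢y refl)
  ... | inj₂ (there y∈ys₂) = ∈-++⁺ʳ ys₁ y∈ys₂

module _ {a} {A : Set a} (_≟_ : DecidableEquality A) where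
  open DecMembership _≟_ using (_∈?_)

  fresh-element : {xs ys : List A} → Unique xs → length ys < length xs → ∃ λ x → x ∈ xs × x ∉ ys
  fresh-element {xs} {ys} xs-unique ys<xs with all? (_∈? ys) xs
  ... | yes xs⊆ys = ⊥-elim (<⇒≱ ys<xs (Unique⇒length≤ xs-unique xs⊆ys))
  ... | no xs⊈ys  = find (¬All⇒Any¬ (_∈? ys) xs xs⊈ys)

coloursOnNbhd-weaken : ∀ {m} {G : Graph m} {φ : Coloring m} {v j k} →
                       j ≤ k → ColoursOnNbhdAtLeast G φ v k → ColoursOnNbhdAtLeast G φ v j
coloursOnNbhd-weaken {j = j} j≤k (cs , refl , cs-unique , cs-seen) =
  take j cs , trans (length-take j cs) (m≤n⇒m⊓n≡m j≤k) ,
  Unique.take⁺ j cs-unique , All.take⁺ j cs-seen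

three-neighbour-colours : ∀ {m} (G : Graph m) {φ : Coloring m} v {c₁ c₂ c₃ : ℕ} →
  c₁ ≢ c₂ → c₁ ≢ c₃ → c₂ ≢ c₃ →
  All (λ c → ∃ λ u → Adj G v u × φ u ≡ c) (c₁ ∷ c₂ ∷ c₃ ∷ []) →
  ColoursOnNbhdAtLeast G φ v (3 ⊓ deg G v)
three-neighbour-colours G v c₁≢c₂ c₁≢c₃ c₂≢c₃ seen =
  coloursOnNbhd-weaken {G = G} (m⊓n≤m 3 (deg G v))
    (_ , refl , (c₁≢c₂ ∷ c₁≢c₃ ∷ []) ∷ (c₂≢c₃ ∷ []) ∷ [] ∷ [] , seen)

coloursOnNbhd-bounded : ∀ {m} {G : Graph m} {φ : Coloring m} {v k} {cs : List ℕ} →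
  ColoursOnNbhdAtLeast G φ v k → (∀ u → Adj G v u → φ u ∈ cs) → k ≤ length cs
coloursOnNbhd-bounded {G = G} {φ} {v} {cs = cs} (ds , refl , ds-unique , ds-seen) covered =
  Unique⇒length≤ ds-unique (All.map seen⇒covered ds-seen)
  where
  seen⇒covered : ∀ {c} → (∃ λ u → Adj G v u × φ u ≡ c) → c ∈ cs
  seen⇒covered (u , adj , refl) = covered u adj

module GreedyRim (h : ℕ) (A : ℕ → List ℕ)
                 (A-size : ∀ i → Unique (A i) × 6 ≤ length (A i)) where

  choose : ∀ i (ys : List ℕ) → length ys ≤ 5 → ∃ λ c → c ∈ A i × c ∉ ys
  choose i ys ys≤5 =
    fresh-element ℕ._≟_ (proj₁ (A-size i)) (≤-trans (s≤s ys≤5) (proj₂ (A-size i)))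

  c₀ c₁ : ℕ
  c₀ = proj₁ (choose 0 [ h ] (s≤s z≤n))
  c₁ = proj₁ (choose 1 (h ∷ c₀ ∷ []) (s≤s (s≤s z≤n)))

  colour : ℕ → ℕ
  colour zero          = c₀
  colour (suc zero)    = c₁
  colour (suc (suc k)) = proj₁ (choose (2 + k) (h ∷ c₀ ∷ c₁ ∷ colour k ∷ colour (suc k) ∷ []) ≤-refl)

  forbidden : ℕ → List ℕ
  forbidden zero          = [ h ]
  forbidden (suc zero)    = h ∷ c₀ ∷ []
  forbidden (suc (suc k)) = h ∷ c₀ ∷ c₁ ∷ colour k ∷ colour (suc k) ∷ []

  colour-chosen : ∀ i → colour i ∈ A i × colour i ∉ forbidden i
  colour-chosen zero          = proj₂ (choose 0 _ (s≤s z≤n))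
  colour-chosen (suc zero)    = proj₂ (choose 1 _ (s≤s (s≤s z≤n)))
  colour-chosen (suc (suc k)) = proj₂ (choose (2 + k) _ ≤-refl)

  colour-avoids : ∀ j {c} → c ∈ forbidden j → c ≢ colour j
  colour-avoids j c∈ refl = proj₂ (colour-chosen j) c∈

  hub-avoids : ∀ j → h ≢ colour j
  hub-avoids zero          = colour-avoids 0 (here refl)
  hub-avoids (suc zero)    = colour-avoids 1 (here refl)
  hub-avoids (suc (suc k)) = colour-avoids (2 + k) (here refl)

  colour-≢-suc : ∀ i → colour i ≢ colour (suc i)
  colour-≢-suc zero    = colour-avoids 1 (there (here refl))
  colour-≢-suc (suc k) = colour-avoids (2 + k) (there (there (there (there (here refl)))))

  colour-≢-2+ : ∀ i → colour i ≢ colour (suc (suc i))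
  colour-≢-2+ i = colour-avoids (2 + i) (there (there (there (here refl))))

  colour-≢-initial : ∀ {i j} → i ≤ 1 → i < j → colour i ≢ colour j
  colour-≢-initial {zero}     {suc zero}    _ _ = colour-≢-suc 0
  colour-≢-initial {zero}     {suc (suc k)} _ _ = colour-avoids (2 + k) (there (here refl))
  colour-≢-initial {suc zero} {suc (suc k)} _ _ = colour-avoids (2 + k) (there (there (here refl)))
  colour-≢-initial {suc zero} {suc zero}    _ (s≤s ())
  colour-≢-initial {suc (suc i)} (s≤s ())

suc-%-cases : ∀ {i n} .{{_ : NonZero n}} → i < n →
              suc i % n ≡ suc i × suc i < n ⊎ suc i % n ≡ 0 × suc i ≡ n
suc-%-cases {i} {n} i<n with suc i <? n
... | yes 1+i<n = inj₁ (m<n⇒m%n≡m 1+i<n , 1+i<n)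
... | no 1+i≮n  = inj₂ (trans (cong (_% n) 1+i≡n) (n%n≡0 n) , 1+i≡n)
  where 1+i≡n = ≤-antisym i<n (≮⇒≥ 1+i≮n)

∃-pred-% : ∀ {i n} .{{_ : NonZero n}} → i < n → ∃ λ p → p < n × i ≡ suc p % n
∃-pred-% {zero}  {n} _   =
  pred n , subst (pred n <_) (suc-pred n) ≤-refl , sym (trans (cong (_% n) (suc-pred n)) (n%n≡0 n))
∃-pred-% {suc i} {n} i<n = i , <-trans (n<1+n i) i<n , sym (m<n⇒m%n≡m i<n)

toℕ-mod : ∀ {n} .{{_ : NonZero n}} (v : Fin n) → toℕ v mod n ≡ v
toℕ-mod {n} v = toℕ-injective (trans (toℕ-fromℕ< (m%n<n (toℕ v) n)) (m<n⇒m%n≡m (toℕ<n v)))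

rim-vertex : ∀ {i n} → i < n → Fin (suc n)
rim-vertex i<n = F.suc (fromℕ< i<n)

module _ {n : ℕ} .{{_ : NonZero n}} where

  wheel-rim-adj⁻ : ∀ (v u : Fin n) → Adj (wheel n) (F.suc v) (F.suc u) →
                   toℕ u ≡ suc (toℕ v) % n ⊎ toℕ v ≡ suc (toℕ u) % n
  wheel-rim-adj⁻ _ _ adj = Sum.map (≡ᵇ⇒≡ _ _) (≡ᵇ⇒≡ _ _) (Equivalence.to T-∨ adj)

  wheel-adj-next : ∀ (v : Fin n) {j} (j<n : j < n) → j ≡ suc (toℕ v) % n →
                   Adj (wheel n) (F.suc v) (rim-vertex j<n)
  wheel-adj-next v j<n refl = Equivalence.from T-∨ (inj₁ (≡⇒≡ᵇ _ _ (toℕ-fromℕ< j<n)))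

  wheel-adj-prev : ∀ (v : Fin n) {j} (j<n : j < n) → toℕ v ≡ suc j % n →
                   Adj (wheel n) (F.suc v) (rim-vertex j<n)
  wheel-adj-prev v {j} j<n v≡ =
    Equivalence.from T-∨ (inj₂ (≡⇒≡ᵇ _ _ (subst (λ k → toℕ v ≡ suc k % n) (sym (toℕ-fromℕ< j<n)) v≡)))

module UpperBound (n : ℕ) .{{_ : NonZero n}} (n≥3 : 3 ≤ n)
                  (L : ListAssignment (suc n)) (L-size : HasSizeAtLeast 6 L) where

  hub-choice : ∃ λ h → h ∈ L F.zero × h ∉ []
  hub-choice =
    fresh-element ℕ._≟_ (proj₁ (L-size F.zero)) (≤-trans (s≤s z≤n) (proj₂ (L-size F.zero)))

  -- Reducing indices mod n extends the rim lists to all of ℕ, so the greedy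
  -- sequence needs no range conditions.
  open GreedyRim (proj₁ hub-choice) (λ i → L (F.suc (i mod n))) (λ i → L-size (F.suc (i mod n)))

  φ : Coloring (suc n)
  φ F.zero    = proj₁ hub-choice
  φ (F.suc v) = colour (toℕ v)

  φ-rim-vertex : ∀ {i} (i<n : i < n) → φ (rim-vertex i<n) ≡ colour i
  φ-rim-vertex i<n = cong colour (toℕ-fromℕ< i<n)

  φ-∈-L : ∀ v → φ v ∈ L v
  φ-∈-L F.zero    = proj₁ (proj₂ hub-choice)
  φ-∈-L (F.suc v) =
    subst (λ w → colour (toℕ v) ∈ L (F.suc w)) (toℕ-mod v) (proj₁ (colour-chosen (toℕ v)))

  2≤-before-wrap : ∀ {i} → suc i ≡ n → 2 ≤ i
  2≤-before-wrap 1+i≡n = s≤s⁻¹ (subst (3 ≤_) (sym 1+i≡n) n≥3)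

  colour-≢-next : ∀ {i} → i < n → colour i ≢ colour (suc i % n)
  colour-≢-next {i} i<n with suc-%-cases i<n
  ... | inj₁ (next≡ , _)     rewrite next≡ = colour-≢-suc i
  ... | inj₂ (next≡ , 1+i≡n) rewrite next≡ =
    ≢-sym (colour-≢-initial z≤n (≤-trans (s≤s z≤n) (2≤-before-wrap 1+i≡n)))

  colour-≢-next² : ∀ {i} → i < n → colour i ≢ colour (suc (suc i % n) % n)
  colour-≢-next² {i} i<n with suc-%-cases i<n
  ... | inj₂ (next≡ , 1+i≡n) rewrite next≡ | m<n⇒m%n≡m (≤-trans (s≤s (s≤s z≤n)) n≥3) =
    ≢-sym (colour-≢-initial ≤-refl (2≤-before-wrap 1+i≡n))
  ... | inj₁ (next≡ , 1+i<n) rewrite next≡ with suc-%-cases 1+i<n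
  ...   | inj₁ (next²≡ , _)     rewrite next²≡ = colour-≢-2+ i
  ...   | inj₂ (next²≡ , 2+i≡n) rewrite next²≡ =
    ≢-sym (colour-≢-initial z≤n (s≤s⁻¹ (2≤-before-wrap 2+i≡n)))

  proper : Proper (wheel n) φ
  proper F.zero    F.zero    ()
  proper F.zero    (F.suc u) _ = hub-avoids (toℕ u)
  proper (F.suc v) F.zero    _ = ≢-sym (hub-avoids (toℕ v))
  proper (F.suc v) (F.suc u) adj with wheel-rim-adj⁻ v u adj
  ... | inj₁ u≡next rewrite u≡next = colour-≢-next (toℕ<n v)
  ... | inj₂ v≡next rewrite v≡next = ≢-sym (colour-≢-next (toℕ<n u))

  dynamic : ∀ v → ColoursOnNbhdAtLeast (wheel n) φ v (3 ⊓ deg (wheel n) v)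
  dynamic F.zero =
    three-neighbour-colours (wheel n) F.zero (colour-≢-suc 0) (colour-≢-2+ 0) (colour-≢-suc 1)
      (seen (≤-trans (s≤s z≤n) n≥3) ∷ seen (≤-trans (s≤s (s≤s z≤n)) n≥3) ∷ seen n≥3 ∷ [])
    where
    seen : ∀ {i} (i<n : i < n) → ∃ λ u → Adj (wheel n) F.zero u × φ u ≡ colour i
    seen i<n = rim-vertex i<n , tt , φ-rim-vertex i<n
  dynamic (F.suc w) with ∃-pred-% (toℕ<n w)
  ... | p , p<n , w≡next-p =
    three-neighbour-colours (wheel n) (F.suc w) (hub-avoids p) (hub-avoids j) prev≢next
      ( (F.zero , tt , refl)
      ∷ (rim-vertex p<n , wheel-adj-prev w p<n w≡next-p , φ-rim-vertex p<n)
      ∷ (rim-vertex j<n , wheel-adj-next w j<n refl , φ-rim-vertex j<n)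
      ∷ [])
    where
    j = suc (toℕ w) % n
    j<n = m%n<n (suc (toℕ w)) n
    prev≢next : colour p ≢ colour j
    prev≢next rewrite w≡next-p = colour-≢-next² p<n

  colouring : DynamicallyLColorable 3 (wheel n) L
  colouring = φ , (proper , dynamic) , φ-∈-L

wheel-ch₃≤6 : (n : ℕ) → .{{_ : NonZero n}} → 3 ≤ n → ChDynAtMost 3 (wheel n) 6
wheel-ch₃≤6 n n≥3 L L-size = UpperBound.colouring n n≥3 L L-size

dynamic-separates : ∀ {m} {G : Graph m} {φ : Coloring m} v {x a b : Fin m} →
  IsDynamic 3 G φ → 3 ≤ deg G v → (∀ u → Adj G v u → u ∈ x ∷ a ∷ b ∷ []) → φ a ≢ φ b
dynamic-separates {G = G} {φ} v {x} {a} (_ , dynamic) 3≤deg nbhd φa≡φb =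
  <⇒≱ ≤-refl (subst (_≤ 2) (m≤n⇒m⊓n≡m 3≤deg) (coloursOnNbhd-bounded {G = G} (dynamic v) covered))
  where
  covered : ∀ u → Adj G v u → φ u ∈ φ x ∷ φ a ∷ []
  covered u adj with nbhd u adj
  ... | here refl                 = here refl
  ... | there (here refl)         = there (here refl)
  ... | there (there (here refl)) = there (here (sym φa≡φb))

nbhd-within? : ∀ {m} (G : Graph m) v (us : List (Fin m)) → Dec (∀ u → Adj G v u → u ∈ us)
nbhd-within? G v us = Fin.all? λ u → T? (G v u) →-dec (u ∈? us)
  where open DecMembership F._≟_ using (_∈?_)

five-colours : ListAssignment 6
five-colours _ = 0 ∷ 1 ∷ 2 ∷ 3 ∷ 4 ∷ []

five-colours-size : HasSizeAtLeast 5 five-colours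
five-colours-size _ = distinct , ≤-refl
  where
  distinct : Unique (five-colours F.zero)
  distinct = ((λ ()) ∷ (λ ()) ∷ (λ ()) ∷ (λ ()) ∷ []) ∷ ((λ ()) ∷ (λ ()) ∷ (λ ()) ∷ [])
           ∷ ((λ ()) ∷ (λ ()) ∷ []) ∷ ((λ ()) ∷ []) ∷ [] ∷ []

wheel₅-ch₃≰5 : ¬ ChDynAtMost 3 (wheel 5) 5
wheel₅-ch₃≰5 choosable with choosable five-colours five-colours-size
... | φ , φ-dynamic@(proper , _) , φ-∈-L =
  <⇒≱ ≤-refl (Unique⇒length≤ six-distinct
    (φ-∈-L _ ∷ φ-∈-L _ ∷ φ-∈-L _ ∷ φ-∈-L _ ∷ φ-∈-L _ ∷ φ-∈-L _ ∷ []))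
  where
  adj : ∀ u w → {True (T? (wheel 5 u w))} → φ u ≢ φ w
  adj u w {u~w} = proper u w (toWitness u~w)
  sep : ∀ v u w → {True (3 ≤? deg (wheel 5) v)} →
        {True (nbhd-within? (wheel 5) v (# 0 ∷ u ∷ w ∷ []))} → φ u ≢ φ w
  sep v u w {3≤deg} {nbhd} = dynamic-separates v φ-dynamic (toWitness 3≤deg) (toWitness nbhd)
  six-distinct : Unique (φ (# 0) ∷ φ (# 1) ∷ φ (# 2) ∷ φ (# 3) ∷ φ (# 4) ∷ φ (# 5) ∷ [])
  six-distinct = ( adj (# 0) (# 1) ∷ adj (# 0) (# 2) ∷ adj (# 0) (# 3)
                 ∷ adj (# 0) (# 4) ∷ adj (# 0) (# 5) ∷ [])
               ∷ (adj (# 1) (# 2) ∷ sep (# 2) (# 1) (# 3) ∷ sep (# 5) (# 1) (# 4) ∷ adj (# 1) (# 5) ∷ [])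
               ∷ (adj (# 2) (# 3) ∷ sep (# 3) (# 2) (# 4) ∷ sep (# 1) (# 2) (# 5) ∷ [])
               ∷ (adj (# 3) (# 4) ∷ sep (# 4) (# 3) (# 5) ∷ [])
               ∷ (adj (# 4) (# 5) ∷ [])
               ∷ [] ∷ []

proposition1 : ((n : ℕ) → .{{_ : NonZero n}} → 3 ≤ n → ChDynAtMost 3 (wheel n) 6)
                 × ChDynEq 3 (wheel 5) 6
proposition1 = wheel-ch₃≤6 , wheel-ch₃≤6 5 (s≤s (s≤s (s≤s z≤n))) , wheel₅-ch₃≰5
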